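{- Let $P$ be a 0/1-polytope and let $G$ be its skeleton. Then $G$ is a prefix graph.
   Context: A 0/1-polytope is $P=\mathrm{conv}(X)$ for some $X\subseteq\{0,1\}^n$; its skeleton is the graph $G=(X,E)$ of its vertices and edges (1-dimensional faces). For a graph $G=(X,E)$ with $X\subseteq\{0,1\}^n$ and $b\in\{0,1\}$, let $X^b:=\{x\in X: x_n=b\}$, let $x^-$ be $x$ with its last bit deleted, $X^{b- }:=\{x^-:x\in X^b\}$, and $G^{b- }:=(X^{b- },E^{b- })$ with $E^{b- }:=\{(x,y):x,y\in X^{b- },(xb,yb)\in E\}$ (where $xb$ is concatenation). $G$ is a prefix graph if $X=\emptyset$, or $n=0$ and $X=\{\varepsilon\}$ (empty string), or $n>0$ and: (p1) $G^{0- }$ and $G^{1- }$ are prefix graphs; (p2) if $X^0$ and $X^1$ are both nonempty, then for every $b\in\{0,1\}$ and every $x\in X^b$ there is $y\in X^{1-b}$ with $(x,y)\in E$. -}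

module Defs where

open import Data.Bool using (Bool; true; false; not; if_then_else_)
open import Data.Nat using (ℕ; zero; suc)
open import Data.Integer using (ℤ; _+_; _<_; 0ℤ)
open import Data.Vec using (Vec; []; _∷_; _∷ʳ_; foldr′; zipWith)
open import Data.Product using (Σ; ∃; _×_)
open import Data.Sum using (_⊎_)
open import Data.Unit using (⊤)
open import Relation.Binary.PropositionalEquality using (_≡_; _≢_)

BitSet : ℕ → Set
BitSet n = Vec Bool n → Bool

_∈X_ : ∀ {n} → Vec Bool n → BitSet n → Set
x ∈X X = X x ≡ true

-- A graph on X: an edge relation on {0,1}^n (only edges between points of X matter).
Rel : ℕ → Set₁
Rel n = Vec Bool n → Vec Bool n → Set

EmptySet : ∀ {n} → BitSet n → Set
EmptySet X = ∀ x → X x ≡ false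

NonEmpty : ∀ {n} → BitSet n → Set
NonEmpty X = ∃ λ x → x ∈X X

-- X^{b-} and E^{b-}  (the last bit is removed; x b = x ∷ʳ b)
subX : ∀ {n} → BitSet (suc n) → Bool → BitSet n
subX X b x = X (x ∷ʳ b)

subE : ∀ {n} → BitSet (suc n) → Rel (suc n) → Bool → Rel n
subE X E b x y = (x ∈X subX X b) × (y ∈X subX X b) × E (x ∷ʳ b) (y ∷ʳ b)

IsPrefix : (n : ℕ) → BitSet n → Rel n → Set
IsPrefix zero X E = EmptySet X ⊎ ((X [] ≡ true) × (∀ x → x ∈X X → x ≡ []))
IsPrefix (suc n) X E =
  EmptySet X ⊎
  ( (IsPrefix n (subX X false) (subE X E false)
       × IsPrefix n (subX X true) (subE X E true))
  × (NonEmpty (subX X false) → NonEmpty (subX X true) →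
       ∀ (b : Bool) (x : Vec Bool n) → (x ∷ʳ b) ∈X X →
       ∃ λ (y : Vec Bool n) → ((y ∷ʳ not b) ∈X X) × E (x ∷ʳ b) (y ∷ʳ not b)))

dot : ∀ {n} → Vec ℤ n → Vec Bool n → ℤ
dot c x = foldr′ _+_ 0ℤ (zipWith (λ ci xi → if xi then ci else 0ℤ) c x)

-- Skeleton of P = conv(X): the vertices of P are exactly the points of X
-- (every 0/1 point is a vertex of the cube), and distinct x, y ∈ X span an
-- edge iff conv{x,y} is a face of P, i.e. some linear functional c attains
-- its maximum over X exactly at {x, y}.  (Faces of rational polytopes are
-- exposed by integer functionals, so c ranges over ℤ^n.)
SkelEdge : ∀ {n} → BitSet n → Rel n
SkelEdge {n} X x y =
  (x ∈X X) × (y ∈X X) × (x ≢ y) ×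
  (∃ λ (c : Vec ℤ n) → (dot c x ≡ dot c y) ×
     (∀ z → z ∈X X → z ≢ x → z ≢ y → dot c z < dot c x))

{-# OPTIONS --safe #-}
-- Induction on n.  Each facet x_n = b of conv X is a face, so its edges are
-- edges of conv X: tilt an exposing functional c by ±(1 + ‖c‖₁)·x_n to push
-- the opposite facet below the exposed edge.
--
-- For the crossing condition at a vertex x b, choose y on the opposite facet
-- minimising dist x y = Σᵢ 2ⁱ·[xᵢ ≠ yᵢ].  The functional with coefficients
-- ±2ⁱ (sign given by xᵢ) equals its value at x minus dist x, so on the facet
-- of x it is maximised only at x; raising the opposite facet by dist x y then
-- makes x b and y (1−b) its only maximisers on X.  The weights 2ⁱ make dist x
-- injective, which rules out ties on the opposite facet.
module Submission where

open import Data.Nat using (ℕ)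
open import Defs

open import Data.Bool using (Bool; true; false; not; _xor_; if_then_else_)
open import Data.Bool.Properties using (not-¬; not-injective; xor-same)
open import Data.Nat as ℕ using (zero; suc; _≤_; _≤?_)
import Data.Nat.Properties as ℕ
import Data.Nat.Tactic.RingSolver as ℕ-Solver
open import Data.Integer as ℤ using (ℤ; +_; -[1+_]; 0ℤ; ∣_∣; -_; _+_; _-_; _<_; +<+; +≤+; -≤+)
import Data.Integer.Properties as ℤ
open import Algebra.Properties.CommutativeSemigroup ℤ.+-commutativeSemigroup using (interchange)
open import Data.Integer.Tactic.RingSolver using (solve-∀)
open import Data.Vec using (Vec; []; _∷_; _∷ʳ_; initLast; map; sum)
open import Data.Vec.Properties using (∷ʳ-injectiveˡ; ∷ʳ-injectiveʳ)
open import Data.Product using (∃; _×_; _,_)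
open import Data.Sum using (_⊎_; inj₁; inj₂)
open import Function using (_∘_)
open import Relation.Nullary using (¬_; yes; no; contradiction)
open import Relation.Binary.PropositionalEquality

IsPrefix-mono : ∀ {n} {X : BitSet n} {E E′ : Rel n} →
                (∀ {x y} → x ∈X X → y ∈X X → E x y → E′ x y) →
                IsPrefix n X E → IsPrefix n X E′
IsPrefix-mono {zero}  _    p            = p
IsPrefix-mono {suc n} _    (inj₁ empty) = inj₁ empty
IsPrefix-mono {suc n} {X} {E} {E′} E⊆E′ (inj₂ ((prefix₀ , prefix₁) , cross)) =
  inj₂ ((IsPrefix-mono facet prefix₀ , IsPrefix-mono facet prefix₁) , cross′)
  where
  facet : ∀ {b x y} → x ∈X subX X b → y ∈X subX X b → subE X E b x y → subE X E′ b x y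
  facet _ _ (x∈ , y∈ , e) = x∈ , y∈ , E⊆E′ x∈ y∈ e
  cross′ : NonEmpty (subX X false) → NonEmpty (subX X true) →
           ∀ b x → (x ∷ʳ b) ∈X X → ∃ λ y → ((y ∷ʳ not b) ∈X X) × E′ (x ∷ʳ b) (y ∷ʳ not b)
  cross′ ne₀ ne₁ b x x∈ = let y , y∈ , e = cross ne₀ ne₁ b x x∈ in y , y∈ , E⊆E′ x∈ y∈ e

data Side {n} (b : Bool) : Vec Bool (suc n) → Set where
  same     : ∀ z → Side b (z ∷ʳ b)
  opposite : ∀ z → Side b (z ∷ʳ not b)

side : ∀ {n} b (w : Vec Bool (suc n)) → Side b w
side b w with initLast w
side false _ | z , false , refl = same z
side false _ | z , true  , refl = opposite z
side true  _ | z , false , refl = opposite z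
side true  _ | z , true  , refl = same z

dot-∷ʳ : ∀ {n} (c : Vec ℤ n) t (z : Vec Bool n) a →
         dot (c ∷ʳ t) (z ∷ʳ a) ≡ dot c z + (if a then t else 0ℤ)
dot-∷ʳ []       t []       a = ℤ.+-comm (if a then t else 0ℤ) 0ℤ
dot-∷ʳ (cᵢ ∷ c) t (zᵢ ∷ z) a =
  trans (cong (_+_ (if zᵢ then cᵢ else 0ℤ)) (dot-∷ʳ c t z a))
        (sym (ℤ.+-assoc (if zᵢ then cᵢ else 0ℤ) (dot c z) (if a then t else 0ℤ)))

module Tilt {n} (c : Vec ℤ n) (b : Bool) (k : ℤ) where

  tilted : Vec ℤ (suc n)
  tilted = c ∷ʳ (if b then - k else k)

  private
    offset : Bool → ℤ
    offset a = if a then (if b then - k else k) else 0ℤ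

    offset-not : offset (not b) ≡ k + offset b
    offset-not = by-cases b
      where
      by-cases : ∀ b → (if not b then (if b then - k else k) else 0ℤ)
                     ≡ k + (if b then (if b then - k else k) else 0ℤ)
      by-cases false = sym (ℤ.+-identityʳ k)
      by-cases true  = sym (ℤ.+-inverseʳ k)

    dot-same : ∀ z → dot tilted (z ∷ʳ b) ≡ dot c z + offset b
    dot-same z = dot-∷ʳ c _ z b

    dot-opposite : ∀ z → dot tilted (z ∷ʳ not b) ≡ (dot c z + k) + offset b
    dot-opposite z = begin
      dot tilted (z ∷ʳ not b)   ≡⟨ dot-∷ʳ c _ z (not b) ⟩
      dot c z + offset (not b)  ≡⟨ cong (_+_ (dot c z)) offset-not ⟩
      dot c z + (k + offset b)  ≡⟨ ℤ.+-assoc (dot c z) k (offset b) ⟨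
      (dot c z + k) + offset b  ∎
      where open ≡-Reasoning

  same-≡ : ∀ {z x} → dot c z ≡ dot c x → dot tilted (z ∷ʳ b) ≡ dot tilted (x ∷ʳ b)
  same-≡ {z} {x} e =
    trans (dot-same z) (trans (cong (λ i → i + offset b) e) (sym (dot-same x)))

  same-< : ∀ {z x} → dot c z < dot c x → dot tilted (z ∷ʳ b) < dot tilted (x ∷ʳ b)
  same-< {z} {x} h =
    subst₂ _<_ (sym (dot-same z)) (sym (dot-same x)) (ℤ.+-monoˡ-< (offset b) h)

  opposite-≡ : ∀ {z x} → dot c z + k ≡ dot c x →
               dot tilted (z ∷ʳ not b) ≡ dot tilted (x ∷ʳ b)
  opposite-≡ {z} {x} e =
    trans (dot-opposite z) (trans (cong (λ i → i + offset b) e) (sym (dot-same x)))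

  opposite-< : ∀ {z x} → dot c z + k < dot c x →
               dot tilted (z ∷ʳ not b) < dot tilted (x ∷ʳ b)
  opposite-< {z} {x} h =
    subst₂ _<_ (sym (dot-opposite z)) (sym (dot-same x)) (ℤ.+-monoˡ-< (offset b) h)

‖_‖₁ : ∀ {n} → Vec ℤ n → ℕ
‖ c ‖₁ = sum (map ∣_∣ c)

dot≤dot+‖c‖₁ : ∀ {n} (c : Vec ℤ n) z x → dot c z ℤ.≤ dot c x + + ‖ c ‖₁
dot≤dot+‖c‖₁ []       []       []       = ℤ.≤-refl
dot≤dot+‖c‖₁ (cᵢ ∷ c) (zᵢ ∷ z) (xᵢ ∷ x) =
  subst (dot (cᵢ ∷ c) (zᵢ ∷ z) ℤ.≤_) regroup
        (ℤ.+-mono-≤ (entry≤entry+∣c∣ zᵢ xᵢ cᵢ) (dot≤dot+‖c‖₁ c z x))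
  where
  entry≤entry+∣c∣ : ∀ a b i → (if a then i else 0ℤ) ℤ.≤ (if b then i else 0ℤ) + + ∣ i ∣
  entry≤entry+∣c∣ false false i        = +≤+ ℕ.z≤n
  entry≤entry+∣c∣ true  true  i        = ℤ.i≤i+j i (+ ∣ i ∣)
  entry≤entry+∣c∣ true  false (+ m)    = ℤ.≤-refl
  entry≤entry+∣c∣ true  false -[1+ m ] = -≤+
  entry≤entry+∣c∣ false true  (+ m)    = +≤+ ℕ.z≤n
  entry≤entry+∣c∣ false true  -[1+ m ] = ℤ.≤-reflexive (sym (ℤ.+-inverseʳ -[1+ m ]))
  regroup : ((if xᵢ then cᵢ else 0ℤ) + + ∣ cᵢ ∣) + (dot c x + + ‖ c ‖₁)
          ≡ dot (cᵢ ∷ c) (xᵢ ∷ x) + + ‖ cᵢ ∷ c ‖₁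
  regroup = trans (interchange (if xᵢ then cᵢ else 0ℤ) (+ ∣ cᵢ ∣) (dot c x) (+ ‖ c ‖₁))
                  (cong (_+_ (dot (cᵢ ∷ c) (xᵢ ∷ x))) (sym (ℤ.pos-+ ∣ cᵢ ∣ ‖ c ‖₁)))

i<j+k⇒i-k<j : ∀ {i j k} → i < j + k → i - k < j
i<j+k⇒i-k<j {i} {j} {k} h = subst (i - k <_) (j+k-k≡j j k) (ℤ.+-monoˡ-< (- k) h)
  where
  j+k-k≡j : ∀ j k → (j + k) - k ≡ j
  j+k-k≡j = solve-∀

SkelEdge-∷ʳ : ∀ {n} (X : BitSet (suc n)) {b x y} →
              SkelEdge (subX X b) x y → SkelEdge X (x ∷ʳ b) (y ∷ʳ b)
SkelEdge-∷ʳ X {b} {x} {y} (x∈ , y∈ , x≢y , c , cx≡cy , c-max) =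
  x∈ , y∈ , x≢y ∘ ∷ʳ-injectiveˡ x y , tilted , same-≡ cx≡cy , tilted-max
  where
  open Tilt c b (- + suc ‖ c ‖₁)
  tilted-max : ∀ w → w ∈X X → w ≢ x ∷ʳ b → w ≢ y ∷ʳ b → dot tilted w < dot tilted (x ∷ʳ b)
  tilted-max w w∈ w≢x w≢y with side b w
  ... | same z     = same-< (c-max z w∈ (w≢x ∘ cong (_∷ʳ b)) (w≢y ∘ cong (_∷ʳ b)))
  ... | opposite z = opposite-< (i<j+k⇒i-k<j (ℤ.≤-<-trans (dot≤dot+‖c‖₁ c z x)
                                  (ℤ.+-monoʳ-< (dot c x) (+<+ (ℕ.n<1+n ‖ c ‖₁)))))

bit : Bool → ℕ
bit false = 0
bit true  = 1

dist : ∀ {n} → Vec Bool n → Vec Bool n → ℕ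
dist []      []      = 0
dist (a ∷ x) (b ∷ z) = bit (a xor b) ℕ.+ 2 ℕ.* dist x z

bit+2*-injective : ∀ p q {m m′} → bit p ℕ.+ 2 ℕ.* m ≡ bit q ℕ.+ 2 ℕ.* m′ → p ≡ q × m ≡ m′
bit+2*-injective false false {m} {m′} e = refl , ℕ.*-cancelˡ-≡ m m′ 2 e
bit+2*-injective true  true  {m} {m′} e = refl , ℕ.*-cancelˡ-≡ m m′ 2 (ℕ.suc-injective e)
bit+2*-injective false true  {m} {m′} e = contradiction e (ℕ.even≢odd m m′)
bit+2*-injective true  false {m} {m′} e = contradiction (sym e) (ℕ.even≢odd m′ m)

xor-cancelˡ : ∀ a {b c} → a xor b ≡ a xor c → b ≡ c
xor-cancelˡ false e = e
xor-cancelˡ true  e = not-injective e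

dist-injective : ∀ {n} (x : Vec Bool n) {z y} → dist x z ≡ dist x y → z ≡ y
dist-injective []      {[]}    {[]}    _ = refl
dist-injective (a ∷ x) {b ∷ z} {c ∷ y} e =
  let a⊕b≡a⊕c , dz≡dy = bit+2*-injective (a xor b) (a xor c) e
  in cong₂ _∷_ (xor-cancelˡ a a⊕b≡a⊕c) (dist-injective x dz≡dy)

dist-self : ∀ {n} (x : Vec Bool n) → dist x x ≡ 0
dist-self []      = refl
dist-self (a ∷ x) rewrite xor-same a | dist-self x = refl

dist≡0⇒≡ : ∀ {n} (x : Vec Bool n) {z} → dist x z ≡ 0 → z ≡ x
dist≡0⇒≡ x e = dist-injective x (trans e (sym (dist-self x)))

towards : ∀ {n} → ℕ → Vec Bool n → Vec ℤ n
towards k []      = []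
towards k (a ∷ x) = (if a then + k else - + k) ∷ towards (2 ℕ.* k) x

towards-entry : ∀ a b k → let cₐ = if a then + k else - + k in
                (if b then cₐ else 0ℤ) + + (k ℕ.* bit (a xor b)) ≡ (if a then cₐ else 0ℤ)
towards-entry false false k rewrite ℕ.*-zeroʳ k     = refl
towards-entry false true  k rewrite ℕ.*-identityʳ k = ℤ.+-inverseˡ (+ k)
towards-entry true  false k rewrite ℕ.*-identityʳ k = refl
towards-entry true  true  k rewrite ℕ.*-zeroʳ k     = ℤ.+-identityʳ (+ k)

dot-towards : ∀ {n} k (x z : Vec Bool n) →
              dot (towards k x) z + + (k ℕ.* dist x z) ≡ dot (towards k x) x
dot-towards k []      []      rewrite ℕ.*-zeroʳ k = refl
dot-towards k (a ∷ x) (b ∷ z) = begin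
  (entry b + dot c z) + + (k ℕ.* (bit (a xor b) ℕ.+ 2 ℕ.* dist x z))
    ≡⟨ cong (λ m → (entry b + dot c z) + + m) (distrib k (bit (a xor b)) (dist x z)) ⟩
  (entry b + dot c z) + + (k ℕ.* bit (a xor b) ℕ.+ 2 ℕ.* k ℕ.* dist x z)
    ≡⟨ cong (_+_ (entry b + dot c z)) (ℤ.pos-+ (k ℕ.* bit (a xor b)) (2 ℕ.* k ℕ.* dist x z)) ⟩
  (entry b + dot c z) + (+ (k ℕ.* bit (a xor b)) + + (2 ℕ.* k ℕ.* dist x z))
    ≡⟨ interchange (entry b) (dot c z) (+ (k ℕ.* bit (a xor b))) (+ (2 ℕ.* k ℕ.* dist x z)) ⟩
  (entry b + + (k ℕ.* bit (a xor b))) + (dot c z + + (2 ℕ.* k ℕ.* dist x z))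
    ≡⟨ cong₂ _+_ (towards-entry a b k) (dot-towards (2 ℕ.* k) x z) ⟩
  entry a + dot c x ∎
  where
  open ≡-Reasoning
  c = towards (2 ℕ.* k) x
  entry : Bool → ℤ
  entry d = if d then (if a then + k else - + k) else 0ℤ
  distrib : ∀ k d m → k ℕ.* (d ℕ.+ 2 ℕ.* m) ≡ k ℕ.* d ℕ.+ 2 ℕ.* k ℕ.* m
  distrib = ℕ-Solver.solve-∀

dot-towards-1 : ∀ {n} (x z : Vec Bool n) →
                dot (towards 1 x) z + + dist x z ≡ dot (towards 1 x) x
dot-towards-1 x z = subst (λ m → dot (towards 1 x) z + + m ≡ dot (towards 1 x) x)
                          (ℕ.*-identityˡ (dist x z)) (dot-towards 1 x z)

towards-gap : ∀ {n m} (x : Vec Bool n) {z} → m ℕ.< dist x z →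
              dot (towards 1 x) z + + m < dot (towards 1 x) x
towards-gap x {z} m<d =
  subst (dot (towards 1 x) z + + _ <_) (dot-towards-1 x z)
        (ℤ.+-monoʳ-< (dot (towards 1 x) z) (+<+ m<d))

towards-max : ∀ {n} (x : Vec Bool n) {z} → z ≢ x → dot (towards 1 x) z < dot (towards 1 x) x
towards-max x z≢x =
  subst (_< _) (ℤ.+-identityʳ _) (towards-gap x (ℕ.n≢0⇒n>0 (z≢x ∘ dist≡0⇒≡ x)))

∉-empty : ∀ {n} {Y : BitSet n} {x} → EmptySet Y → ¬ x ∈X Y
∉-empty {x = x} empty x∈ = contradiction (trans (sym (empty x)) x∈) λ ()

Minimiser : ∀ {n} → BitSet n → (Vec Bool n → ℕ) → Vec Bool n → Set
Minimiser Y f y = y ∈X Y × (∀ z → z ∈X Y → f y ≤ f z)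

argmin : ∀ {n} (Y : BitSet n) (f : Vec Bool n → ℕ) → EmptySet Y ⊎ ∃ (Minimiser Y f)
argmin {zero} Y f with Y [] in Y[]
... | false = inj₁ λ { [] → Y[] }
... | true  = inj₂ ([] , Y[] , λ { [] _ → ℕ.≤-refl })
argmin {suc n} Y f
  with argmin (Y ∘ (false ∷_)) (f ∘ (false ∷_)) | argmin (Y ∘ (true ∷_)) (f ∘ (true ∷_))
... | inj₁ empty₀ | inj₁ empty₁ =
  inj₁ λ { (false ∷ z) → empty₀ z ; (true ∷ z) → empty₁ z }
... | inj₂ (y , y∈ , min) | inj₁ empty₁ =
  inj₂ (false ∷ y , y∈ , λ { (false ∷ z) z∈ → min z z∈
                           ; (true  ∷ z) z∈ → contradiction z∈ (∉-empty empty₁) })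
... | inj₁ empty₀ | inj₂ (y , y∈ , min) =
  inj₂ (true ∷ y , y∈ , λ { (false ∷ z) z∈ → contradiction z∈ (∉-empty empty₀)
                          ; (true  ∷ z) z∈ → min z z∈ })
... | inj₂ (y₀ , y₀∈ , min₀) | inj₂ (y₁ , y₁∈ , min₁) with f (false ∷ y₀) ≤? f (true ∷ y₁)
...   | yes y₀≤y₁ =
  inj₂ (false ∷ y₀ , y₀∈ , λ { (false ∷ z) z∈ → min₀ z z∈
                             ; (true  ∷ z) z∈ → ℕ.≤-trans y₀≤y₁ (min₁ z z∈) })
...   | no  y₀≰y₁ =
  inj₂ (true ∷ y₁ , y₁∈ , λ { (false ∷ z) z∈ → ℕ.≤-trans (ℕ.≰⇒≥ y₀≰y₁) (min₀ z z∈)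
                            ; (true  ∷ z) z∈ → min₁ z z∈ })

crossing-edge : ∀ {n} (X : BitSet (suc n)) {b x} →
                (x ∷ʳ b) ∈X X → NonEmpty (subX X (not b)) →
                ∃ λ y → ((y ∷ʳ not b) ∈X X) × SkelEdge X (x ∷ʳ b) (y ∷ʳ not b)
crossing-edge X {b} {x} x∈ (y₀ , y₀∈) with argmin (subX X (not b)) (dist x)
... | inj₁ empty            = contradiction y₀∈ (∉-empty empty)
... | inj₂ (y , y∈ , y-min) =
  y , y∈ , x∈ , y∈ , not-¬ refl ∘ ∷ʳ-injectiveʳ x y ,
  tilted , sym (opposite-≡ (dot-towards-1 x y)) , tilted-max
  where
  open Tilt (towards 1 x) b (+ dist x y)
  tilted-max : ∀ w → w ∈X X → w ≢ x ∷ʳ b → w ≢ y ∷ʳ not b → dot tilted w < dot tilted (x ∷ʳ b)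
  tilted-max w w∈ w≢x w≢y with side b w
  ... | same z     = same-< (towards-max x (w≢x ∘ cong (_∷ʳ b)))
  ... | opposite z = opposite-< (towards-gap x (ℕ.≤∧≢⇒< (y-min z w∈)
                                  (w≢y ∘ cong (_∷ʳ not b) ∘ sym ∘ dist-injective x)))

lemma15 : (n : ℕ) (X : BitSet n) → IsPrefix n X (SkelEdge X)
lemma15 zero X with X [] in X[]
... | false = inj₁ λ { [] → X[] }
... | true  = inj₂ (refl , λ { [] _ → refl })
lemma15 (suc n) X =
  inj₂ ( (facet false , facet true)
       , λ { ne₀ ne₁ false _ x∈ → crossing-edge X x∈ ne₁
           ; ne₀ ne₁ true  _ x∈ → crossing-edge X x∈ ne₀ } )
  where
  facet : ∀ b → IsPrefix n (subX X b) (subE X (SkelEdge X) b)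
  facet b = IsPrefix-mono (λ x∈ y∈ e → x∈ , y∈ , SkelEdge-∷ʳ X e) (lemma15 n (subX X b))
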